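{- Let $n\ge 0$ and $0\le m\le 2^n$. If $m\le 2^n-1$, write the design $\{m\}_n$ as $1^{k_0}0^{k_1}1^{k_2}\cdots 0^{k_{l-2}}1^{k_{l-1}}$ with $l$ odd, $k_0\ge 0$, $k_i\ge1$ for $i=1,\dots,l-2$, and $k_{l-1}\ge 0$; if $m=2^n$, take $l=3$ and $(k_0,k_1,k_2)=(1,n,0)$. Then \[ [2^n:m]=[k_0,k_1,\dots,k_{l-1}]. \] In particular, if $k_{l-1}=0$ and $l\ge3$, then $[2^n:m]=[k_0,k_1,\dots,k_{l-3}]$.
   Context: Stern's diatomic integers: for integers $n\ge0$, $0\le m\le 2^n$, define $[2^0:0]=0$, $[2^0:1]=1$, $[2^{n+1}:2m]=[2^n:m]$ ($0\le m\le 2^n$), $[2^{n+1}:2m+1]=[2^n:m]+[2^n:m+1]$ ($0\le m\le 2^n-1$). For $0\le m\le 2^n-1$, $\{m\}_n$ is the binary word $d_1\cdots d_n$ of length $n$ (leading zeros allowed, empty if $n=0$) with $\sum 2^{n-i}d_i=m$; $x^k$ denotes $k$ copies of the letter $x$. Every finite binary word has a unique such run decomposition. Continuant: $[x_0]=x_0$, $[x_0,x_1]=x_0x_1+1$, and $[x_0,\dots,x_{l-1}]=[x_0,\dots,x_{l-2}]\,x_{l-1}+[x_0,\dots,x_{l-3}]$ for $l\ge 3$; for the empty sequence $[\,]=1$ (so the recursion also holds for $l=2$). -}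

module Defs where

open import Data.Nat using (ℕ; zero; suc; _+_; _*_; _^_; _<_; _≤_; _%_; _/_)
open import Data.Bool using (Bool; true; false; not; if_then_else_)
open import Data.List using (List; []; _∷_; _++_; replicate; length; foldl; lookup)
open import Data.Fin using (Fin; toℕ)
open import Data.Product using (_×_; _,_; proj₁)
open import Data.Sum using (_⊎_)
open import Relation.Binary.PropositionalEquality using (_≡_)

-- Stern's diatomic integers: stern n m = [2^n : m]  (meaningful for m ≤ 2^n;
-- out-of-range values are an arbitrary junk value 0).
stern : ℕ → ℕ → ℕ
stern zero zero = 0
stern zero (suc zero) = 1
stern zero (suc (suc _)) = 0
stern (suc n) m =
  if m % 2 Data.Nat.≡ᵇ 0
  then stern n (m / 2)
  else stern n (m / 2) + stern n (suc (m / 2))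

-- {m}_n : binary word d_1 ... d_n of length n with Σ 2^{n-i} d_i = m
-- (true = letter 1, false = letter 0); most significant digit first.
bits : ℕ → ℕ → List Bool
bits zero m = []
bits (suc n) m = bits n (m / 2) ++ ((m % 2 Data.Nat.≡ᵇ 1) ∷ [])

runs : Bool → List ℕ → List Bool
runs b [] = []
runs b (k ∷ ks) = replicate k b ++ runs (not b) ks

-- Continuant [x_0,...,x_{l-1}], computed by the defining recursion
-- [x_0..x_j] = [x_0..x_{j-1}] x_j + [x_0..x_{j-2}], with [ ] = 1 and the
-- convention [x_0..x_{-2}] = 0 (so that [x_0] = x_0, [x_0,x_1] = x_0 x_1 + 1).
contStep : ℕ × ℕ → ℕ → ℕ × ℕ
contStep (a , b) x = (a * x + b , a)

cont : List ℕ → ℕ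
cont xs = proj₁ (foldl contStep (1 , 0) xs)

IsDecomp : ℕ → ℕ → List ℕ → Set
IsDecomp n m ks =
  (m < 2 ^ n
    × length ks % 2 ≡ 1
    × ((i : Fin (length ks)) → 0 < toℕ i → suc (toℕ i) < length ks → 1 ≤ lookup ks i)
    × bits n m ≡ runs true ks)
  ⊎ (m ≡ 2 ^ n × ks ≡ 1 ∷ n ∷ 0 ∷ [])

{-# OPTIONS --safe #-}
module Submission where

-- Reading {m}_n from its most significant digit, the pair ([2^j : q], [2^j : q+1]) attached to
-- the prefix q starts at (0, 1) and is updated by (a, b) ↦ (a, a + b) on a 0 and (a + b, b) on
-- a 1. A run of k equal letters therefore adds k times one coordinate to the other, which is the
-- continuant recursion [x_0..x_j] = [x_0..x_{j-1}] x_j + [x_0..x_{j-2}] acting on the pair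
-- (current, previous), up to the order of the two coordinates. That order flips with every run,
-- and since there is an odd number of runs the first coordinate ends up being [k_0..k_{l-1}].

open import Defs
open import Data.Nat using (ℕ; zero; suc; _+_; _*_; _^_; _<_; _%_; _/_; s≤s)
open import Data.Nat.Properties
  using (+-assoc; +-comm; +-identityʳ; *-comm; *-zeroʳ; *-cancelʳ-<; n≤1+n; ≤-trans)
open import Data.Nat.DivMod using (m*n/n≡m; m*n%n≡0; [m+kn]%n≡m%n; +-distrib-/-∣ʳ)
open import Data.Nat.Divisibility using (divides-refl)
open import Data.Bool using (Bool; true; false; not)
open import Data.List using (List; []; _∷_; _++_; replicate; length; foldl)
open import Data.List.Properties using (foldl-++)
open import Data.Product using (_×_; _,_; proj₁)
open import Data.Sum using (inj₁; inj₂)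
open import Relation.Binary.PropositionalEquality
  using (_≡_; _≢_; refl; sym; trans; cong; subst; module ≡-Reasoning)
open ≡-Reasoning

data Halving : ℕ → Set where
  even : ∀ q → Halving (q * 2)
  odd  : ∀ q → Halving (suc (q * 2))

halving : ∀ m → Halving m
halving zero = even 0
halving (suc m) with halving m
... | even q = odd q
... | odd q  = even (suc q)

[1+q*2]/2≡q : ∀ q → suc (q * 2) / 2 ≡ q
[1+q*2]/2≡q q = trans (+-distrib-/-∣ʳ 1 {d = 2} (divides-refl q)) (m*n/n≡m q 2)

q*2<2^[1+n]⇒q<2^n : ∀ n q → q * 2 < 2 ^ suc n → q < 2 ^ n
q*2<2^[1+n]⇒q<2^n n q h = *-cancelʳ-< 2 q (2 ^ n) (subst (q * 2 <_) (*-comm 2 (2 ^ n)) h)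

stern-even : ∀ n q → stern (suc n) (q * 2) ≡ stern n q
stern-even n q rewrite m*n%n≡0 q 2 ⦃ _ ⦄ | m*n/n≡m q 2 ⦃ _ ⦄ = refl

stern-odd : ∀ n q → stern (suc n) (suc (q * 2)) ≡ stern n q + stern n (suc q)
stern-odd n q rewrite [m+kn]%n≡m%n 1 q 2 ⦃ _ ⦄ | [1+q*2]/2≡q q = refl

bits-even : ∀ n q → bits (suc n) (q * 2) ≡ bits n q ++ false ∷ []
bits-even n q rewrite m*n%n≡0 q 2 ⦃ _ ⦄ | m*n/n≡m q 2 ⦃ _ ⦄ = refl

bits-odd : ∀ n q → bits (suc n) (suc (q * 2)) ≡ bits n q ++ true ∷ []
bits-odd n q rewrite [m+kn]%n≡m%n 1 q 2 ⦃ _ ⦄ | [1+q*2]/2≡q q = refl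

stern-2^ : ∀ n → stern n (2 ^ n) ≡ 1
stern-2^ zero = refl
stern-2^ (suc n) rewrite *-comm 2 (2 ^ n) | stern-even n (2 ^ n) = stern-2^ n

sternStep : ℕ × ℕ → Bool → ℕ × ℕ
sternStep (a , b) false = (a , a + b)
sternStep (a , b) true  = (a + b , b)

stern-pair : ∀ n m → m < 2 ^ n →
             (stern n m , stern n (suc m)) ≡ foldl sternStep (0 , 1) (bits n m)
stern-pair zero zero _ = refl
stern-pair zero (suc m) (s≤s ())
stern-pair (suc n) m m<2^n with halving m
... | even q
  rewrite stern-even n q | stern-odd n q | bits-even n q
        | foldl-++ sternStep (0 , 1) (bits n q) (false ∷ [])
        | sym (stern-pair n q (q*2<2^[1+n]⇒q<2^n n q m<2^n)) = refl
... | odd q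
  rewrite stern-odd n q | stern-even n (suc q) | bits-odd n q
        | foldl-++ sternStep (0 , 1) (bits n q) (true ∷ [])
        | sym (stern-pair n q (q*2<2^[1+n]⇒q<2^n n q (≤-trans (n≤1+n _) m<2^n))) = refl

foldl-sternStep-ones : ∀ k a b → foldl sternStep (a , b) (replicate k true) ≡ (a + k * b , b)
foldl-sternStep-ones zero    a b = cong (_, b) (sym (+-identityʳ a))
foldl-sternStep-ones (suc k) a b
  rewrite foldl-sternStep-ones k (a + b) b = cong (_, b) (+-assoc a b (k * b))

foldl-sternStep-zeros : ∀ k a b → foldl sternStep (a , b) (replicate k false) ≡ (a , b + k * a)
foldl-sternStep-zeros zero    a b = cong (a ,_) (sym (+-identityʳ b))
foldl-sternStep-zeros (suc k) a b
  rewrite foldl-sternStep-zeros k a (a + b) = cong (a ,_) (begin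
    a + b + k * a    ≡⟨ cong (_+ k * a) (+-comm a b) ⟩
    b + a + k * a    ≡⟨ +-assoc b a (k * a) ⟩
    b + (a + k * a)  ∎)

p+k*c≡c*k+p : ∀ p k c → p + k * c ≡ c * k + p
p+k*c≡c*k+p p k c = trans (+-comm p (k * c)) (cong (_+ p) (*-comm k c))

-- A continuant state (c , p) = ([x_0..x_j] , [x_0..x_{j-1}]) appears in the Stern pair as
-- (p , c) before a run of 1s and as (c , p) before a run of 0s.
orient : Bool → ℕ × ℕ → ℕ × ℕ
orient true  (c , p) = (p , c)
orient false s       = s

foldl-sternStep-run : ∀ b k s →
                      foldl sternStep (orient b s) (replicate k b) ≡ orient (not b) (contStep s k)
foldl-sternStep-run true  k (c , p)
  rewrite foldl-sternStep-ones k p c = cong (_, c) (p+k*c≡c*k+p p k c)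
foldl-sternStep-run false k (c , p)
  rewrite foldl-sternStep-zeros k c p = cong (c ,_) (p+k*c≡c*k+p p k c)

afterRuns : Bool → List ℕ → Bool
afterRuns b []       = b
afterRuns b (_ ∷ ks) = afterRuns (not b) ks

afterRuns-odd : ∀ b ks → length ks % 2 ≡ 1 → afterRuns b ks ≡ not b
afterRuns-odd b     (_ ∷ [])     _ = refl
afterRuns-odd true  (_ ∷ _ ∷ ks) h = afterRuns-odd true ks h
afterRuns-odd false (_ ∷ _ ∷ ks) h = afterRuns-odd false ks h

foldl-sternStep-runs : ∀ b ks s →
  foldl sternStep (orient b s) (runs b ks) ≡ orient (afterRuns b ks) (foldl contStep s ks)
foldl-sternStep-runs b []       s = refl
foldl-sternStep-runs b (k ∷ ks) s = begin
  foldl sternStep (orient b s) (replicate k b ++ runs (not b) ks)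
    ≡⟨ foldl-++ sternStep (orient b s) (replicate k b) (runs (not b) ks) ⟩
  foldl sternStep (foldl sternStep (orient b s) (replicate k b)) (runs (not b) ks)
    ≡⟨ cong (λ t → foldl sternStep t (runs (not b) ks)) (foldl-sternStep-run b k s) ⟩
  foldl sternStep (orient (not b) (contStep s k)) (runs (not b) ks)
    ≡⟨ foldl-sternStep-runs (not b) ks (contStep s k) ⟩
  orient (afterRuns (not b) ks) (foldl contStep (contStep s k) ks) ∎

stern≡cont-runs : ∀ n m ks → m < 2 ^ n → length ks % 2 ≡ 1 → bits n m ≡ runs true ks →
                  stern n m ≡ cont ks
stern≡cont-runs n m ks m<2^n odd-length bits≡runs = cong proj₁ (begin
  (stern n m , stern n (suc m))
    ≡⟨ stern-pair n m m<2^n ⟩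
  foldl sternStep (orient true (1 , 0)) (bits n m)
    ≡⟨ cong (foldl sternStep (0 , 1)) bits≡runs ⟩
  foldl sternStep (orient true (1 , 0)) (runs true ks)
    ≡⟨ foldl-sternStep-runs true ks (1 , 0) ⟩
  orient (afterRuns true ks) (foldl contStep (1 , 0) ks)
    ≡⟨ cong (λ b → orient b (foldl contStep (1 , 0) ks)) (afterRuns-odd true ks odd-length) ⟩
  foldl contStep (1 , 0) ks ∎)

cont-++-[a,0] : ∀ ks a → cont (ks ++ a ∷ 0 ∷ []) ≡ cont ks
cont-++-[a,0] ks a rewrite foldl-++ contStep (1 , 0) ks (a ∷ 0 ∷ []) =
  cong (_+ cont ks) (*-zeroʳ (proj₁ (contStep (foldl contStep (1 , 0) ks) a)))

stern≡cont : ∀ n m ks → IsDecomp n m ks → stern n m ≡ cont ks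
stern≡cont n m ks (inj₁ (m<2^n , odd-length , _ , bits≡runs)) =
  stern≡cont-runs n m ks m<2^n odd-length bits≡runs
stern≡cont n _ _ (inj₂ (refl , refl)) = trans (stern-2^ n) (sym (cont-++-[a,0] (1 ∷ []) n))

theorem4p3 : (n m : ℕ) (ks : List ℕ) → IsDecomp n m ks →
    stern n m ≡ cont ks
    × ((ks′ : List ℕ) (a b : ℕ) → ks ≡ ks′ ++ a ∷ b ∷ [] → ks′ ≢ [] → b ≡ 0 →
         stern n m ≡ cont ks′)
theorem4p3 n m ks d = stern≡cont n m ks d , drop-last-runs
  where
  drop-last-runs : (ks′ : List ℕ) (a b : ℕ) → ks ≡ ks′ ++ a ∷ b ∷ [] → ks′ ≢ [] → b ≡ 0 →
                   stern n m ≡ cont ks′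
  drop-last-runs ks′ a .0 refl _ refl = trans (stern≡cont n m ks d) (cont-++-[a,0] ks′ a)
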